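{- Let $G$ be a graph and let $M$ be a lift of the cycle matroid $M(G)$. Then $G$ is a framework for $M$. Moreover, if $C_1$ and $C_2$ are vertex-disjoint cycles of $G$, then $E(C_1\cup C_2)$ is dependent in $M$.
   Context: A matroid $M$ is a lift of a matroid $N$ if there is a matroid $M'$ and an element $e\in E(M')$ with $M'\setminus e=M$ and $M'/e=N$. For a graph $G$ and a vertex $v$, $\mathrm{loops}_G(v)$ denotes the set of loop-edges of $G$ at $v$. Graphs are finite and may have loops and parallel edges (a loop-edge is a cycle of length one). For a set $X$ of edges, $G[X]$ is the subgraph of $G$ with edge-set $X$ and no isolated vertices. A graph $G$ is a framework for a matroid $M$ if (1) $E(G)=E(M)$; (2) $r_M(E(H))\le |V(H)|$ for each component $H$ of $G$; (3) for each vertex $v$ of $G$, $\mathrm{cl}_M(E(G-v))\subseteq E(G-v)\cup \mathrm{loops}_G(v)$; and (4) for each circuit $C$ of $M$, the subgraph $G[C]$ has at most two components. -}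

module Defs where

open import Data.Nat using (ℕ; zero; suc; _+_; _≤_)
open import Data.Fin using (Fin; zero; suc; _≟_)
open import Data.Fin.Subset using (Subset; _∈_; _∉_; _⊆_; _⊂_; _∪_; ⁅_⁆; ∣_∣; ⊥; ⊤; Nonempty; inside; outside)
open import Data.Bool using (Bool; true; false; if_then_else_; not; _∧_)
open import Data.Vec using (Vec; _∷_; lookup; tabulate)
open import Data.Product using (Σ; ∃; ∃-syntax; _×_; _,_; proj₁; proj₂)
open import Data.Sum using (_⊎_)
open import Relation.Nullary using (¬_; does)
open import Relation.Binary.PropositionalEquality using (_≡_)
open import Function.Bundles using (_⇔_)

record Matroid (n : ℕ) : Set where
  field
    indep     : Subset n → Bool
    indep-∅   : indep ⊥ ≡ true
    indep-⊆   : ∀ {X Y} → Y ⊆ X → indep X ≡ true → indep Y ≡ true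
    indep-aug : ∀ {X Y} → indep X ≡ true → indep Y ≡ true → suc ∣ X ∣ ≤ ∣ Y ∣ →
                ∃[ e ] (e ∈ Y × e ∉ X × indep (X ∪ ⁅ e ⁆) ≡ true)

module _ {n : ℕ} (M : Matroid n) where
  open Matroid M

  Indep : Subset n → Set
  Indep X = indep X ≡ true

  Dependent : Subset n → Set
  Dependent X = ¬ Indep X

  Circuit : Subset n → Set
  Circuit C = Dependent C × (∀ D → D ⊂ C → Indep D)

  RankLe : Subset n → ℕ → Set
  RankLe X k = ∀ I → I ⊆ X → Indep I → ∣ I ∣ ≤ k

  IsRank : Subset n → ℕ → Set
  IsRank X k = (∃[ I ] (I ⊆ X × Indep I × ∣ I ∣ ≡ k)) × RankLe X k

  InClosure : Subset n → Fin n → Set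
  InClosure X e = ∃[ k ] (IsRank X k × IsRank (X ∪ ⁅ e ⁆) k)

-- Deletion and contraction of the element  zero  of a matroid on Fin (suc n)
-- (the new element e of M' is placed at position zero).

module _ {n : ℕ} (M′ : Matroid (suc n)) where
  open Matroid M′

  deleteIndep : Subset n → Bool
  deleteIndep X = indep (outside ∷ X)

  -- independence in M' / e : if e is not a loop, X is independent iff X ∪ {e}
  -- is independent in M'; if e is a loop, M'/e = M'\e.
  contractIndep : Subset n → Bool
  contractIndep X = if indep ⁅ zero ⁆ then indep (inside ∷ X) else indep (outside ∷ X)

-- Finite graphs (loops and parallel edges allowed): vertices Fin nV, edges
-- Fin nE, each edge with two (possibly equal) ends.

record Graph : Set where
  field
    nV   : ℕ
    nE   : ℕ
    ends : Fin nE → Fin nV × Fin nV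

sumFin : ∀ {n} → (Fin n → ℕ) → ℕ
sumFin {zero}  f = 0
sumFin {suc n} f = f zero + sumFin (λ i → f (suc i))

module _ (G : Graph) where
  open Graph G

  end₁ end₂ : Fin nE → Fin nV
  end₁ e = proj₁ (ends e)
  end₂ e = proj₂ (ends e)

  IsEnd : Fin nV → Fin nE → Set
  IsEnd v e = (end₁ e ≡ v) ⊎ (end₂ e ≡ v)

  IsLoopAt : Fin nV → Fin nE → Set
  IsLoopAt v e = (end₁ e ≡ v) × (end₂ e ≡ v)

  Touches : Subset nE → Fin nV → Set
  Touches X v = ∃[ e ] (e ∈ X × IsEnd v e)

  data Reach (X : Subset nE) : Fin nV → Fin nV → Set where
    here : ∀ {u} → Reach X u u
    step₁ : ∀ {u w} e → e ∈ X → end₁ e ≡ u → Reach X (end₂ e) w → Reach X u w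
    step₂ : ∀ {u w} e → e ∈ X → end₂ e ≡ u → Reach X (end₁ e) w → Reach X u w

  -- edges f and g lie in the same component of G[X]
  Linked : Subset nE → Fin nE → Fin nE → Set
  Linked X f g = Reach X (end₁ f) (end₁ g)

  -- degree of v in G[X] (a loop-edge counts twice)
  degree : Subset nE → Fin nV → ℕ
  degree X v = sumFin (λ e → if lookup X e
                               then ((if does (end₁ e ≟ v) then 1 else 0)
                                     + (if does (end₂ e ≟ v) then 1 else 0))
                               else 0)

  IsCycle : Subset nE → Set
  IsCycle C = Nonempty C
            × (∀ f g → f ∈ C → g ∈ C → Linked C f g)
            × (∀ v → Touches C v → degree C v ≡ 2)

  -- independence in the cycle matroid M(G): G[X] contains no cycle
  Acyclic : Subset nE → Set
  Acyclic X = ¬ (∃[ C ] (C ⊆ X × IsCycle C))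

  VertexDisjoint : Subset nE → Subset nE → Set
  VertexDisjoint C₁ C₂ = ∀ v → ¬ (Touches C₁ v × Touches C₂ v)

  IsComponent : Subset nV → Set
  IsComponent VS = Nonempty VS
                 × (∀ u w → u ∈ VS → w ∈ VS → Reach ⊤ u w)
                 × (∀ e → (end₁ e ∈ VS → end₂ e ∈ VS) × (end₂ e ∈ VS → end₁ e ∈ VS))

  componentEdges : Subset nV → Subset nE
  componentEdges VS = tabulate (λ e → lookup VS (end₁ e))

  edgesAvoiding : Fin nV → Subset nE
  edgesAvoiding v = tabulate (λ e → not (does (end₁ e ≟ v)) ∧ not (does (end₂ e ≟ v)))

  -- G is a framework for M  (condition (1), E(G) = E(M), holds by typing)
  IsFramework : Matroid nE → Set
  IsFramework M =
      (∀ VS → IsComponent VS → RankLe M (componentEdges VS) ∣ VS ∣)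
    × (∀ v e → InClosure M (edgesAvoiding v) e → e ∈ edgesAvoiding v ⊎ IsLoopAt v e)
    × (∀ C → Circuit M C →
         ∃[ a ] ∃[ b ] (a ∈ C × b ∈ C × (∀ f → f ∈ C → Linked C a f ⊎ Linked C b f)))

  -- M is a lift of the cycle matroid M(G): there is a matroid M' on
  -- E(M) together with one new element e (position zero of Fin (suc nE))
  -- with M' \ e = M and M' / e = M(G).
  IsLiftOfCycleMatroid : Matroid nE → Set
  IsLiftOfCycleMatroid M =
    ∃[ M′ ] ((∀ X → deleteIndep M′ X ≡ Matroid.indep M X)
           × (∀ X → (contractIndep M′ X ≡ true) ⇔ Acyclic X))

module Submission where

-- Let 0 be the new element of M′, so M′ \ 0 = M and M′ / 0 = M(G). Forests of G are independent in M, and,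
-- since r(M′ \ 0) ≤ r(M′ / 0) + 1, every set independent in M contains a forest missing at most one of its
-- elements. A forest spanning the vertices of a component H has fewer than |V(H)| edges, which is the rank
-- condition; two edge-disjoint cycles in an independent set would make the forest miss two elements, which
-- gives the second claim and, applied to C - c for a circuit C, rules out three components of G[C]. An edge
-- with a single end at v lies on no cycle through E(G - v), so augmenting in M′ shows it is not spanned by
-- E(G - v). The forest bound is proved by contracting an edge, which removes one edge and one vertex.

open import Defs
open import Data.Fin.Subset using (_∪_)
open import Data.Product using (_×_)
open import Relation.Nullary using (¬_)

open import Data.Bool using (Bool; true; false; if_then_else_; not; _∧_; _∨_)
open import Data.Empty using (⊥-elim) renaming (⊥ to ⊥₀)
open import Data.Fin using (Fin; zero; suc; _≟_)
import Data.Fin.Properties as Finₚ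
open Finₚ using (any?)
open import Function using (_∘_; id)
open import Data.Fin.Subset
  using (Subset; _∈_; _∉_; _⊆_; _⊂_; ⁅_⁆; ∣_∣; ⊥; Nonempty; inside; outside; _-_)
open import Data.Fin.Subset.Properties
open import Data.Fin.Subset.Induction using (⊂-wellFounded)
open import Data.Nat using (ℕ; zero; suc; _+_; _≤_; _<_; z≤n; s≤s)
open import Data.Nat.Induction using (<-wellFounded)
open import Data.Nat.Properties hiding (_≟_)
open import Algebra.Properties.CommutativeSemigroup +-commutativeSemigroup using (interchange)
open import Data.Product using (∃-syntax; _,_; proj₁; proj₂)
open import Data.Sum using (_⊎_; inj₁; inj₂; [_,_]′)
open import Data.Vec using (_∷_; lookup; tabulate; here; there)
open import Data.Vec.Properties using (lookup-zipWith; lookup∘tabulate; []=⇒lookup; lookup⇒[]=)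
open import Function.Bundles using (_⇔_; Equivalence; mk⇔)
open import Induction.WellFounded using (Acc; acc)
open import Relation.Binary.PropositionalEquality
  using (module ≡-Reasoning; _≡_; _≢_; refl; sym; trans; cong; cong₂; subst; subst₂)
open import Relation.Nullary using (Dec; yes; no; does; contradiction)
open import Relation.Nullary.Decidable
  using (decidable-stable; map′; _⊎-dec_; _×-dec_; ¬?; dec-true; dec-false)

sumFin-cong : ∀ {n} {f g : Fin n → ℕ} → (∀ i → f i ≡ g i) → sumFin f ≡ sumFin g
sumFin-cong {zero}  f≗g = refl
sumFin-cong {suc n} f≗g = cong₂ _+_ (f≗g zero) (sumFin-cong (λ i → f≗g (suc i)))

sumFin-+ : ∀ {n} (f g : Fin n → ℕ) → sumFin (λ i → f i + g i) ≡ sumFin f + sumFin g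
sumFin-+ {zero}  f g = refl
sumFin-+ {suc n} f g = trans (cong (f zero + g zero +_) (sumFin-+ (λ i → f (suc i)) (λ i → g (suc i))))
                             (interchange (f zero) (g zero) _ _)

sumFin-zero : ∀ {n} {f : Fin n → ℕ} → (∀ i → f i ≡ 0) → sumFin f ≡ 0
sumFin-zero {zero}  f≗0 = refl
sumFin-zero {suc n} f≗0 = cong₂ _+_ (f≗0 zero) (sumFin-zero (λ i → f≗0 (suc i)))

sumFin-single : ∀ {n} (f : Fin n → ℕ) i → (∀ j → j ≢ i → f j ≡ 0) → sumFin f ≡ f i
sumFin-single {suc n} f zero    f≗0 =
  trans (cong (f zero +_) (sumFin-zero (λ j → f≗0 (suc j) (λ ())))) (+-identityʳ (f zero))
sumFin-single {suc n} f (suc i) f≗0 =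
  trans (cong (_+ sumFin (λ j → f (suc j))) (f≗0 zero (λ ())))
        (sumFin-single (λ j → f (suc j)) i (λ j j≢i → f≗0 (suc j) (j≢i ∘ Finₚ.suc-injective)))

term≤sumFin : ∀ {n} (f : Fin n → ℕ) i → f i ≤ sumFin f
term≤sumFin f zero    = m≤m+n (f zero) _
term≤sumFin f (suc i) = ≤-trans (term≤sumFin (λ j → f (suc j)) i) (m≤n+m _ (f zero))

sumFin-pos⇒term-pos : ∀ {n} (f : Fin n → ℕ) → 1 ≤ sumFin f → ∃[ i ] 1 ≤ f i
sumFin-pos⇒term-pos {suc n} f pos with f zero in eq
... | suc _ = zero , subst (1 ≤_) (sym eq) (s≤s z≤n)
... | zero with sumFin-pos⇒term-pos (λ i → f (suc i)) pos
...   | i , fi-pos = suc i , fi-pos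

module _ {n : ℕ} where

  x∈p∪⁅y⁆⁻ : ∀ {p : Subset n} {x y} → x ∈ p ∪ ⁅ y ⁆ → x ∈ p ⊎ x ≡ y
  x∈p∪⁅y⁆⁻ {p} {x} {y} x∈ with x∈p∪q⁻ p ⁅ y ⁆ x∈
  ... | inj₁ x∈p  = inj₁ x∈p
  ... | inj₂ x∈⁅y⁆ = inj₂ (x∈⁅y⁆⇒x≡y y x∈⁅y⁆)

  y∈p∪⁅y⁆ : ∀ {p : Subset n} {y} → y ∈ p ∪ ⁅ y ⁆
  y∈p∪⁅y⁆ {y = y} = x∈p∪q⁺ (inj₂ (x∈⁅x⁆ y))

  p∪⁅x⁆⊆q : ∀ {p q : Subset n} {x} → p ⊆ q → x ∈ q → p ∪ ⁅ x ⁆ ⊆ q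
  p∪⁅x⁆⊆q p⊆q x∈q y∈ with x∈p∪⁅y⁆⁻ y∈
  ... | inj₁ y∈p  = p⊆q y∈p
  ... | inj₂ refl = x∈q

  x∈p-y⁻ : ∀ {p : Subset n} {x y} → x ∈ p - y → x ∈ p × x ≢ y
  x∈p-y⁻ {p} {x} {y} x∈ = p─q⊆p p ⁅ y ⁆ x∈ , λ { refl → x∉p-x p x x∈ }
    where
    x∉p-x : ∀ {m} (p : Subset m) x → x ∉ p - x
    x∉p-x (_ ∷ p) (suc x) (there x∈) = x∉p-x p x x∈

  p⊆p-x∪⁅x⁆ : ∀ (p : Subset n) x → p ⊆ (p - x) ∪ ⁅ x ⁆
  p⊆p-x∪⁅x⁆ p x {y} y∈p with y ≟ x
  ... | yes refl = y∈p∪⁅y⁆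
  ... | no  y≢x  = x∈p∪q⁺ (inj₁ (x∈p∧x≢y⇒x∈p-y y∈p y≢x))

  ∣p∪⁅x⁆∣≡1+∣p∣ : ∀ {p : Subset n} {x} → x ∉ p → ∣ p ∪ ⁅ x ⁆ ∣ ≡ suc ∣ p ∣
  ∣p∪⁅x⁆∣≡1+∣p∣ {p} {x} x∉p = go p x x∉p
    where
    go : ∀ {m} (p : Subset m) x → x ∉ p → ∣ p ∪ ⁅ x ⁆ ∣ ≡ suc ∣ p ∣
    go (true  ∷ p) zero    x∉p = contradiction here x∉p
    go (false ∷ p) zero    x∉p = cong (suc ∘ ∣_∣) (∪-identityʳ p)
    go (true  ∷ p) (suc x) x∉p = cong suc (go p x (x∉p ∘ there))
    go (false ∷ p) (suc x) x∉p = go p x (x∉p ∘ there)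

  1+∣p-x∣≡∣p∣ : ∀ {p : Subset n} {x} → x ∈ p → suc ∣ p - x ∣ ≡ ∣ p ∣
  1+∣p-x∣≡∣p∣ {p} {x} x∈p = ≤-antisym (x∈p⇒∣p-x∣<∣p∣ x∈p)
    (subst (∣ p ∣ ≤_) (∣p∪⁅x⁆∣≡1+∣p∣ {p - x} (λ x∈p-x → proj₂ (x∈p-y⁻ x∈p-x) refl))
                      (p⊆q⇒∣p∣≤∣q∣ (p⊆p-x∪⁅x⁆ p x)))

  ⁅x⁆⊆p : ∀ {p : Subset n} {x} → x ∈ p → ⁅ x ⁆ ⊆ p
  ⁅x⁆⊆p {p} {x} x∈p {y} y∈⁅x⁆ = subst (_∈ p) (sym (x∈⁅y⁆⇒x≡y x y∈⁅x⁆)) x∈p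

  nonempty⇒∣p∣≥1 : ∀ {p : Subset n} → Nonempty p → 1 ≤ ∣ p ∣
  nonempty⇒∣p∣≥1 {p} (x , x∈p) = subst (_≤ ∣ p ∣) (∣⁅x⁆∣≡1 x) (p⊆q⇒∣p∣≤∣q∣ (⁅x⁆⊆p x∈p))

  ∈-tabulate⇔ : ∀ {f : Fin n → Bool} {x} → x ∈ tabulate f ⇔ f x ≡ true
  ∈-tabulate⇔ {f} {x} = mk⇔ (λ x∈ → trans (sym (lookup∘tabulate f x)) ([]=⇒lookup x∈))
                            (λ fx → lookup⇒[]= x _ (trans (lookup∘tabulate f x) fx))

  x∈q∖p⇒∣p∣<∣q∣ : ∀ {p q : Subset n} {x} → p ⊆ q → x ∈ q → x ∉ p → suc ∣ p ∣ ≤ ∣ q ∣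
  x∈q∖p⇒∣p∣<∣q∣ {p} {q} p⊆q x∈q x∉p =
    subst (_≤ ∣ q ∣) (∣p∪⁅x⁆∣≡1+∣p∣ x∉p) (p⊆q⇒∣p∣≤∣q∣ (p∪⁅x⁆⊆q p⊆q x∈q))

  x,y∈q∖p⇒2+∣p∣≤∣q∣ : ∀ {p q : Subset n} {x y} → p ⊆ q → x ∈ q → y ∈ q → x ∉ p → y ∉ p → x ≢ y →
                      suc (suc ∣ p ∣) ≤ ∣ q ∣
  x,y∈q∖p⇒2+∣p∣≤∣q∣ {p} {q} {x} {y} p⊆q x∈q y∈q x∉p y∉p x≢y =
    subst (λ k → suc k ≤ ∣ q ∣) (∣p∪⁅x⁆∣≡1+∣p∣ x∉p) (x∈q∖p⇒∣p∣<∣q∣ (p∪⁅x⁆⊆q p⊆q x∈q) y∈q y∉p∪⁅x⁆)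
    where
    y∉p∪⁅x⁆ : y ∉ p ∪ ⁅ x ⁆
    y∉p∪⁅x⁆ y∈ with x∈p∪⁅y⁆⁻ y∈
    ... | inj₁ y∈p = y∉p y∈p
    ... | inj₂ y≡x = x≢y (sym y≡x)

  ⊆-or-outside : ∀ (p q : Subset n) → p ⊆ q ⊎ ∃[ x ] (x ∈ p × x ∉ q)
  ⊆-or-outside p q with any? (λ x → x ∈? p ×-dec ¬? (x ∈? q))
  ... | yes witness = inj₂ witness
  ... | no  none    = inj₁ λ {x} x∈p → decidable-stable (x ∈? q) (λ x∉q → none (x , x∈p , x∉q))

module _ {n : ℕ} (M : Matroid n) where
  open Matroid M

  extend-to-size : ∀ d {X Y} → Indep M X → Indep M Y → ∣ Y ∣ ≡ d + ∣ X ∣ →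
                   ∃[ Z ] (X ⊆ Z × Z ⊆ X ∪ Y × Indep M Z × ∣ Z ∣ ≡ ∣ Y ∣)
  extend-to-size zero    {X} indX indY ∣Y∣≡ = X , id , p⊆p∪q _ , indX , sym ∣Y∣≡
  extend-to-size (suc d) {X} {Y} indX indY ∣Y∣≡
    with indep-aug indX indY (subst (suc ∣ X ∣ ≤_) (sym ∣Y∣≡) (s≤s (m≤n+m ∣ X ∣ d)))
  ... | e , e∈Y , e∉X , indXe
    with extend-to-size d indXe indY
           (trans ∣Y∣≡ (trans (sym (+-suc d ∣ X ∣)) (cong (d +_) (sym (∣p∪⁅x⁆∣≡1+∣p∣ e∉X)))))
  ...   | Z , Xe⊆Z , Z⊆XeY , indZ , ∣Z∣≡ = Z , Xe⊆Z ∘ p⊆p∪q _ , Z⊆X∪Y , indZ , ∣Z∣≡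
    where
    Z⊆X∪Y : Z ⊆ X ∪ Y
    Z⊆X∪Y z∈Z with x∈p∪q⁻ (X ∪ ⁅ e ⁆) Y (Z⊆XeY z∈Z)
    ... | inj₂ z∈Y = q⊆p∪q X Y z∈Y
    ... | inj₁ z∈Xe with x∈p∪⁅y⁆⁻ z∈Xe
    ...   | inj₁ z∈X = p⊆p∪q Y z∈X
    ...   | inj₂ refl = q⊆p∪q X Y e∈Y

-- Reachability

module _ (G : Graph) where
  open Graph G

  Reach-trans : ∀ {X u v w} → Reach G X u v → Reach G X v w → Reach G X u w
  Reach-trans here                  r = r
  Reach-trans (step₁ e e∈X refl r′) r = step₁ e e∈X refl (Reach-trans r′ r)
  Reach-trans (step₂ e e∈X refl r′) r = step₂ e e∈X refl (Reach-trans r′ r)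

  Reach-mono : ∀ {X Y u w} → X ⊆ Y → Reach G X u w → Reach G Y u w
  Reach-mono X⊆Y here                 = here
  Reach-mono X⊆Y (step₁ e e∈X refl r) = step₁ e (X⊆Y e∈X) refl (Reach-mono X⊆Y r)
  Reach-mono X⊆Y (step₂ e e∈X refl r) = step₂ e (X⊆Y e∈X) refl (Reach-mono X⊆Y r)

  Reach-edge₁₂ : ∀ {X e} → e ∈ X → Reach G X (end₁ G e) (end₂ G e)
  Reach-edge₁₂ e∈X = step₁ _ e∈X refl here

  Reach-edge₂₁ : ∀ {X e} → e ∈ X → Reach G X (end₂ G e) (end₁ G e)
  Reach-edge₂₁ e∈X = step₂ _ e∈X refl here

  Reach-sym : ∀ {X u w} → Reach G X u w → Reach G X w u
  Reach-sym here                 = here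
  Reach-sym (step₁ e e∈X refl r) = Reach-trans (Reach-sym r) (Reach-edge₂₁ e∈X)
  Reach-sym (step₂ e e∈X refl r) = Reach-trans (Reach-sym r) (Reach-edge₁₂ e∈X)

  Reach-end : ∀ {X v e} → e ∈ X → IsEnd G v e → Reach G X v (end₁ G e)
  Reach-end e∈X (inj₁ refl) = here
  Reach-end e∈X (inj₂ refl) = Reach-edge₂₁ e∈X

  Linked-common : ∀ {X a b f} → Linked G X a f → Linked G X b f → Linked G X a b
  Linked-common a~f b~f = Reach-trans a~f (Reach-sym b~f)

  Reach-⊥ : ∀ {u w} → Reach G ⊥ u w → u ≡ w
  Reach-⊥ here              = refl
  Reach-⊥ (step₁ e e∈⊥ _ _) = contradiction e∈⊥ ∉⊥
  Reach-⊥ (step₂ e e∈⊥ _ _) = contradiction e∈⊥ ∉⊥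

  ReachThrough : Subset nE → Fin nE → Fin nV → Fin nV → Set
  ReachThrough X e u w = (Reach G X u (end₁ G e) × Reach G X (end₂ G e) w)
              ⊎ (Reach G X u (end₂ G e) × Reach G X (end₁ G e) w)

  Reach-∪⁅⁆⇔ : ∀ {X e u w} → Reach G (X ∪ ⁅ e ⁆) u w ⇔ (Reach G X u w ⊎ ReachThrough X e u w)
  Reach-∪⁅⁆⇔ {X} {e} = mk⇔ split join
    where
    prepend : ∀ {u v w} → Reach G X u v → Reach G X v w ⊎ ReachThrough X e v w → Reach G X u w ⊎ ReachThrough X e u w
    prepend r (inj₁ r′)              = inj₁ (Reach-trans r r′)
    prepend r (inj₂ (inj₁ (r₁ , r₂))) = inj₂ (inj₁ (Reach-trans r r₁ , r₂))
    prepend r (inj₂ (inj₂ (r₁ , r₂))) = inj₂ (inj₂ (Reach-trans r r₁ , r₂))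

    split : ∀ {u w} → Reach G (X ∪ ⁅ e ⁆) u w → Reach G X u w ⊎ ReachThrough X e u w
    split here = inj₁ here
    split (step₁ g g∈ refl r) with x∈p∪⁅y⁆⁻ g∈ | split r
    ... | inj₁ g∈X | rest                   = prepend (Reach-edge₁₂ g∈X) rest
    ... | inj₂ refl | inj₁ r′               = inj₂ (inj₁ (here , r′))
    ... | inj₂ refl | inj₂ (inj₁ (_ , r′)) = inj₂ (inj₁ (here , r′))
    ... | inj₂ refl | inj₂ (inj₂ (_ , r′)) = inj₁ r′
    split (step₂ g g∈ refl r) with x∈p∪⁅y⁆⁻ g∈ | split r
    ... | inj₁ g∈X | rest                   = prepend (Reach-edge₂₁ g∈X) rest
    ... | inj₂ refl | inj₁ r′               = inj₂ (inj₂ (here , r′))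
    ... | inj₂ refl | inj₂ (inj₁ (_ , r′)) = inj₁ r′
    ... | inj₂ refl | inj₂ (inj₂ (_ , r′)) = inj₂ (inj₂ (here , r′))

    join : ∀ {u w} → Reach G X u w ⊎ ReachThrough X e u w → Reach G (X ∪ ⁅ e ⁆) u w
    join (inj₁ r)              = Reach-mono (p⊆p∪q _) r
    join (inj₂ (inj₁ (r₁ , r₂))) =
      Reach-trans (Reach-mono (p⊆p∪q _) r₁) (step₁ e y∈p∪⁅y⁆ refl (Reach-mono (p⊆p∪q _) r₂))
    join (inj₂ (inj₂ (r₁ , r₂))) =
      Reach-trans (Reach-mono (p⊆p∪q _) r₁) (step₂ e y∈p∪⁅y⁆ refl (Reach-mono (p⊆p∪q _) r₂))

  Reach? : ∀ X u w → Dec (Reach G X u w)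
  Reach? X = go X (⊂-wellFounded X)
    where
    go : ∀ X → Acc _⊂_ X → ∀ u w → Dec (Reach G X u w)
    go X (acc smaller) u w with nonempty? X
    ... | no empty = map′ (λ { refl → here }) (Reach-⊥ ∘ Reach-mono X⊆⊥) (u ≟ w)
      where
      X⊆⊥ : X ⊆ ⊥
      X⊆⊥ x∈X = contradiction (_ , x∈X) empty
    ... | yes (e , e∈X) =
      map′ (Reach-mono (p∪⁅x⁆⊆q (p─q⊆p X ⁅ e ⁆) e∈X) ∘ Equivalence.from Reach-∪⁅⁆⇔)
           (Equivalence.to Reach-∪⁅⁆⇔ ∘ Reach-mono (p⊆p-x∪⁅x⁆ X e))
           (rec u w ⊎-dec ((rec u (end₁ G e) ×-dec rec (end₂ G e) w)
                     ⊎-dec (rec u (end₂ G e) ×-dec rec (end₁ G e) w)))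
      where
      rec : ∀ u w → Dec (Reach G (X - e) u w)
      rec = go (X - e) (smaller (x∈p⇒p-x⊂p e∈X))

  Linked? : ∀ X f g → Dec (Linked G X f g)
  Linked? X f g = Reach? X (end₁ G f) (end₁ G g)

  componentOf : Subset nE → Fin nE → Subset nE
  componentOf X z = tabulate (λ f → lookup X f ∧ does (Linked? X z f))

  ∈-componentOf⁺ : ∀ {X z f} → f ∈ X → Linked G X z f → f ∈ componentOf X z
  ∈-componentOf⁺ {X} {z} {f} f∈X z~f =
    Equivalence.from ∈-tabulate⇔ (cong₂ _∧_ ([]=⇒lookup f∈X) (dec-true (Linked? X z f) z~f))

  ∈-componentOf⁻ : ∀ {X z f} → f ∈ componentOf X z → f ∈ X × Linked G X z f
  ∈-componentOf⁻ {X} {z} {f} f∈ with lookup X f in f∈X | Linked? X z f | Equivalence.to ∈-tabulate⇔ f∈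
  ... | true | yes z~f | _ = lookup⇒[]= f X f∈X , z~f

-- Degrees

δ : ∀ {n} → Fin n → Fin n → ℕ
δ a v = if does (a ≟ v) then 1 else 0

δ-refl : ∀ {n} (a : Fin n) → δ a a ≡ 1
δ-refl a = cong (if_then 1 else 0) (dec-true (a ≟ a) refl)

δ-≢ : ∀ {n} {a v : Fin n} → a ≢ v → δ a v ≡ 0
δ-≢ {a = a} {v} a≢v = cong (if_then 1 else 0) (dec-false (a ≟ v) a≢v)

module _ (G : Graph) where
  open Graph G

  incidence : Fin nE → Fin nV → ℕ
  incidence e v = δ (end₁ G e) v + δ (end₂ G e) v

  -- degree G X v is definitionally sumFin (degree-term X v)
  degree-term : Subset nE → Fin nV → Fin nE → ℕ
  degree-term X v e = if lookup X e then incidence e v else 0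

  incidence-pos⇒IsEnd : ∀ {e v} → 1 ≤ incidence e v → IsEnd G v e
  incidence-pos⇒IsEnd {e} {v} pos with end₁ G e ≟ v | end₂ G e ≟ v
  ... | yes e₁≡v | _        = inj₁ e₁≡v
  ... | no  _    | yes e₂≡v = inj₂ e₂≡v
  ... | no  _    | no  _    = contradiction pos (λ ())

  touches⇒degree-pos : ∀ {X v} → Touches G X v → 1 ≤ degree G X v
  touches⇒degree-pos {X} {v} (e , e∈X , v-end) =
    ≤-trans (subst (λ b → 1 ≤ (if b then incidence e v else 0)) (sym ([]=⇒lookup e∈X)) (end-pos v-end))
            (term≤sumFin (degree-term X v) e)
    where
    end-pos : IsEnd G v e → 1 ≤ incidence e v
    end-pos (inj₁ refl) = subst (λ k → 1 ≤ k + δ (end₂ G e) v) (sym (δ-refl v)) (s≤s z≤n)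
    end-pos (inj₂ refl) = subst (λ k → 1 ≤ δ (end₁ G e) v + k) (sym (δ-refl v)) (m≤n+m 1 _)

  degree-pos⇒touches : ∀ {X v} → 1 ≤ degree G X v → Touches G X v
  degree-pos⇒touches {X} {v} pos with sumFin-pos⇒term-pos (degree-term X v) pos
  ... | e , term-pos with lookup X e in e∈X
  ...   | true = e , lookup⇒[]= e X e∈X , incidence-pos⇒IsEnd term-pos

  degree≡0⇒avoids : ∀ {X v} → degree G X v ≡ 0 → ∀ {e} → e ∈ X → end₁ G e ≢ v × end₂ G e ≢ v
  degree≡0⇒avoids {X} {v} deg≡0 {e} e∈X = not-end ∘ inj₁ , not-end ∘ inj₂
    where
    not-end : ¬ IsEnd G v e
    not-end end = 1+n≰n (subst (1 ≤_) deg≡0 (touches⇒degree-pos (e , e∈X , end)))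

  incidence-avoiding : ∀ {v e} → e ∈ edgesAvoiding G v → incidence e v ≡ 0
  incidence-avoiding {v} {e} e∈ with end₁ G e ≟ v | end₂ G e ≟ v | Equivalence.to ∈-tabulate⇔ e∈
  ... | no _ | no _ | _ = refl

  avoiding⊎loop⊎end : ∀ v e → e ∈ edgesAvoiding G v ⊎ IsLoopAt G v e ⊎ (IsEnd G v e × incidence e v ≡ 1)
  avoiding⊎loop⊎end v e with end₁ G e ≟ v in e₁≟v | end₂ G e ≟ v in e₂≟v
  ... | yes e₁≡v | yes e₂≡v = inj₂ (inj₁ (e₁≡v , e₂≡v))
  ... | yes e₁≡v | no  _    = inj₂ (inj₂ (inj₁ e₁≡v , refl))
  ... | no  _    | yes e₂≡v = inj₂ (inj₂ (inj₂ e₂≡v , refl))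
  ... | no  _    | no  _    =
    inj₁ (Equivalence.from ∈-tabulate⇔ (cong₂ (λ a b → not (does a) ∧ not (does b)) e₁≟v e₂≟v))

  degree-through : ∀ {X v} e → e ∈ X → (∀ {g} → g ∈ X → g ≢ e → incidence g v ≡ 0) →
                   degree G X v ≡ incidence e v
  degree-through {X} {v} e e∈X others =
    trans (sumFin-single (degree-term X v) e zero-elsewhere)
          (cong (if_then incidence e v else 0) ([]=⇒lookup e∈X))
    where
    zero-elsewhere : ∀ g → g ≢ e → degree-term X v g ≡ 0
    zero-elsewhere g g≢e with lookup X g in g∈X
    ... | true  = others (lookup⇒[]= g X g∈X) g≢e
    ... | false = refl

  degree-⁅⁆ : ∀ e v → degree G ⁅ e ⁆ v ≡ incidence e v
  degree-⁅⁆ e v = degree-through e (x∈⁅x⁆ e) (λ g∈ g≢e → contradiction (x∈⁅y⁆⇒x≡y e g∈) g≢e)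

  degree-∪⁅⁆ : ∀ {X e} v → e ∉ X → degree G (X ∪ ⁅ e ⁆) v ≡ degree G X v + incidence e v
  degree-∪⁅⁆ {X} {e} v e∉X = begin
    degree G (X ∪ ⁅ e ⁆) v                                   ≡⟨ sumFin-cong split-term ⟩
    sumFin (λ g → degree-term X v g + degree-term ⁅ e ⁆ v g) ≡⟨ sumFin-+ _ (degree-term ⁅ e ⁆ v) ⟩
    degree G X v + degree G ⁅ e ⁆ v                          ≡⟨ cong (degree G X v +_) (degree-⁅⁆ e v) ⟩
    degree G X v + incidence e v                             ∎
    where
    open ≡-Reasoning
    split-term : ∀ g → degree-term (X ∪ ⁅ e ⁆) v g ≡ degree-term X v g + degree-term ⁅ e ⁆ v g
    split-term g rewrite lookup-zipWith _∨_ g X ⁅ e ⁆ with lookup X g in g∈X | lookup ⁅ e ⁆ g in g∈⁅e⁆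
    ... | true  | true  =
      contradiction (subst (_∈ X) (x∈⁅y⁆⇒x≡y e (lookup⇒[]= g _ g∈⁅e⁆)) (lookup⇒[]= g X g∈X)) e∉X
    ... | true  | false = sym (+-identityʳ _)
    ... | false | _     = refl

  loop-isCycle : ∀ e → end₁ G e ≡ end₂ G e → IsCycle G ⁅ e ⁆
  loop-isCycle e loop = (e , x∈⁅x⁆ e) , linked , regular
    where
    linked : ∀ f g → f ∈ ⁅ e ⁆ → g ∈ ⁅ e ⁆ → Linked G ⁅ e ⁆ f g
    linked f g f∈ g∈ rewrite x∈⁅y⁆⇒x≡y e f∈ | x∈⁅y⁆⇒x≡y e g∈ = here
    regular : ∀ v → Touches G ⁅ e ⁆ v → degree G ⁅ e ⁆ v ≡ 2
    regular v (g , g∈ , v-end) with x∈⁅y⁆⇒x≡y e g∈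
    ... | refl = trans (degree-⁅⁆ e v) (both-ends v-end)
      where
      both-ends : IsEnd G v e → incidence e v ≡ 2
      both-ends (inj₁ refl) rewrite loop     = cong₂ _+_ (δ-refl (end₂ G e)) (δ-refl (end₂ G e))
      both-ends (inj₂ refl) rewrite sym loop = cong₂ _+_ (δ-refl (end₁ G e)) (δ-refl (end₁ G e))

relabel : (G : Graph) → (Fin (Graph.nV G) → Fin (Graph.nV G)) → Graph
relabel G φ = record
  { nV = Graph.nV G ; nE = Graph.nE G ; ends = λ e → φ (end₁ G e) , φ (end₂ G e) }

-- G[D] and its relabelled copy are isomorphic: τ inverts φ on the vertices of G[D].
module _ (G : Graph) (φ τ : Fin (Graph.nV G) → Fin (Graph.nV G)) {D : Subset (Graph.nE G)}
         (τ∘φ≡id : ∀ {e} → e ∈ D → τ (φ (end₁ G e)) ≡ end₁ G e × τ (φ (end₂ G e)) ≡ end₂ G e)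
         where

  Reach-unrelabel : ∀ {p q} → Reach (relabel G φ) D p q → Reach G D (τ p) (τ q)
  Reach-unrelabel here = here
  Reach-unrelabel (step₁ e e∈D refl r) =
    step₁ e e∈D (sym (proj₁ (τ∘φ≡id e∈D)))
      (subst (λ u → Reach G D u _) (proj₂ (τ∘φ≡id e∈D)) (Reach-unrelabel r))
  Reach-unrelabel (step₂ e e∈D refl r) =
    step₂ e e∈D (sym (proj₂ (τ∘φ≡id e∈D)))
      (subst (λ u → Reach G D u _) (proj₁ (τ∘φ≡id e∈D)) (Reach-unrelabel r))

  isCycle-unrelabel : IsCycle (relabel G φ) D → IsCycle G D
  isCycle-unrelabel (nonempty , linked , regular) = nonempty , linked′ , regular′
    where
    linked′ : ∀ f g → f ∈ D → g ∈ D → Linked G D f g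
    linked′ f g f∈D g∈D =
      subst₂ (Reach G D) (proj₁ (τ∘φ≡id f∈D)) (proj₁ (τ∘φ≡id g∈D))
             (Reach-unrelabel (linked f g f∈D g∈D))

    δ-relabel : ∀ {a v} → τ (φ a) ≡ a → τ (φ v) ≡ v → δ (φ a) (φ v) ≡ δ a v
    δ-relabel {a} {v} τφa τφv with a ≟ v
    ... | yes refl = δ-refl (φ a)
    ... | no  a≢v  = δ-≢ (λ φa≡φv → a≢v (trans (sym τφa) (trans (cong τ φa≡φv) τφv)))

    degree-relabel : ∀ {v} → τ (φ v) ≡ v → degree (relabel G φ) D (φ v) ≡ degree G D v
    degree-relabel {v} τφv = sumFin-cong term
      where
      term : ∀ e → degree-term (relabel G φ) D (φ v) e ≡ degree-term G D v e
      term e with lookup D e in e∈D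
      ... | true  = cong₂ _+_ (δ-relabel (proj₁ (τ∘φ≡id (lookup⇒[]= e D e∈D))) τφv)
                              (δ-relabel (proj₂ (τ∘φ≡id (lookup⇒[]= e D e∈D))) τφv)
      ... | false = refl

    regular′ : ∀ v → Touches G D v → degree G D v ≡ 2
    regular′ v (e , e∈D , inj₁ refl) =
      trans (sym (degree-relabel (proj₁ (τ∘φ≡id e∈D)))) (regular _ (e , e∈D , inj₁ refl))
    regular′ v (e , e∈D , inj₂ refl) =
      trans (sym (degree-relabel (proj₂ (τ∘φ≡id e∈D)))) (regular _ (e , e∈D , inj₂ refl))

-- Identifying the two ends of an edge

redirect : ∀ {n} → Fin n → Fin n → Fin n → Fin n
redirect y x a = if does (a ≟ y) then x else a

redirect-≡ : ∀ {n} {x y : Fin n} → redirect y x y ≡ x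
redirect-≡ {x = x} {y} = cong (if_then x else y) (dec-true (y ≟ y) refl)

redirect-≢ : ∀ {n} {x y a : Fin n} → a ≢ y → redirect y x a ≡ a
redirect-≢ {x = x} {y} {a} a≢y = cong (if_then x else a) (dec-false (a ≟ y) a≢y)

module _ {n} {x y : Fin n} where

  redirect-inverse : ∀ {a} → a ≢ x → redirect x y (redirect y x a) ≡ a
  redirect-inverse {a} a≢x with a ≟ y
  ... | yes refl = redirect-≡ {y = x}
  ... | no  a≢y  = redirect-≢ a≢x

  δ-redirect-target : x ≢ y → ∀ a → δ (redirect y x a) x ≡ δ a x + δ a y
  δ-redirect-target x≢y a with a ≟ y
  ... | yes refl = trans (δ-refl x) (sym (cong (_+ 1) (δ-≢ (x≢y ∘ sym))))
  ... | no  a≢y  = sym (+-identityʳ _)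

  δ-redirect-other : ∀ {w} → w ≢ x → w ≢ y → ∀ a → δ (redirect y x a) w ≡ δ a w
  δ-redirect-other w≢x w≢y a with a ≟ y
  ... | yes refl = trans (δ-≢ (w≢x ∘ sym)) (sym (δ-≢ (w≢y ∘ sym)))
  ... | no  a≢y  = refl

module Contraction (G : Graph) (e : Fin (Graph.nE G)) (x≢y : end₁ G e ≢ end₂ G e) where
  open Graph G

  x y : Fin nV
  x = end₁ G e
  y = end₂ G e

  -- e survives in G/e as a loop at x; only edge sets avoiding e are considered there
  G/e : Graph
  G/e = relabel G (redirect y x)

  degree-G/e-x : ∀ D → degree G/e D x ≡ degree G D x + degree G D y
  degree-G/e-x D = trans (sumFin-cong term) (sumFin-+ (degree-term G D x) (degree-term G D y))
    where
    term : ∀ g → degree-term G/e D x g ≡ degree-term G D x g + degree-term G D y g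
    term g with lookup D g
    ... | true  = trans (cong₂ _+_ (δ-redirect-target x≢y (end₁ G g)) (δ-redirect-target x≢y (end₂ G g)))
                        (interchange (δ (end₁ G g) x) _ _ _)
    ... | false = refl

  degree-G/e-other : ∀ D {w} → w ≢ x → w ≢ y → degree G/e D w ≡ degree G D w
  degree-G/e-other D w≢x w≢y = sumFin-cong term
    where
    term : ∀ g → degree-term G/e D _ g ≡ degree-term G D _ g
    term g with lookup D g
    ... | true  = cong₂ _+_ (δ-redirect-other w≢x w≢y (end₁ G g))
                            (δ-redirect-other w≢x w≢y (end₂ G g))
    ... | false = refl

  toward-x : ∀ {X} u → Reach G (X ∪ ⁅ e ⁆) u (redirect y x u)
  toward-x u with u ≟ y
  ... | yes refl = Reach-edge₂₁ G y∈p∪⁅y⁆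
  ... | no  _    = here

  joined : ∀ {X u u′} → redirect y x u ≡ redirect y x u′ → Reach G (X ∪ ⁅ e ⁆) u u′
  joined {u = u} {u′} same =
    Reach-trans G (toward-x u) (subst (λ v → Reach G _ v u′) (sym same) (Reach-sym G (toward-x u′)))

  Reach-lift : ∀ {D p q} → Reach G/e D p q → ∀ {u w} → redirect y x u ≡ p → redirect y x w ≡ q →
               Reach G (D ∪ ⁅ e ⁆) u w
  Reach-lift here pu pw = joined (trans pu (sym pw))
  Reach-lift (step₁ g g∈D eq r) pu pw =
    Reach-trans G (joined (trans pu (sym eq))) (step₁ g (p⊆p∪q _ g∈D) refl (Reach-lift r refl pw))
  Reach-lift (step₂ g g∈D eq r) pu pw =
    Reach-trans G (joined (trans pu (sym eq))) (step₂ g (p⊆p∪q _ g∈D) refl (Reach-lift r refl pw))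

  module _ {D} (e∉D : e ∉ D) (cycle : IsCycle G/e D) where

    avoiding-y : degree G D y ≡ 0 → IsCycle G D
    avoiding-y dy≡0 = isCycle-unrelabel G (redirect y x) id (λ g∈D → fixed (avoids g∈D)) cycle
      where
      avoids = degree≡0⇒avoids G dy≡0
      fixed : ∀ {a b} → a ≢ y × b ≢ y → redirect y x a ≡ a × redirect y x b ≡ b
      fixed (a≢y , b≢y) = redirect-≢ a≢y , redirect-≢ b≢y

    avoiding-x : degree G D x ≡ 0 → IsCycle G D
    avoiding-x dx≡0 = isCycle-unrelabel G (redirect y x) (redirect x y) (λ g∈D → inverted (avoids g∈D)) cycle
      where
      avoids = degree≡0⇒avoids G dx≡0
      inverted : ∀ {a b} → a ≢ x × b ≢ x → redirect x y (redirect y x a) ≡ a × redirect x y (redirect y x b) ≡ b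
      inverted (a≢x , b≢x) = redirect-inverse a≢x , redirect-inverse b≢x

    degree-x+y : 1 ≤ degree G D x + degree G D y → degree G D x + degree G D y ≡ 2
    degree-x+y pos = trans (sym (degree-G/e-x D))
      (proj₂ (proj₂ cycle) x (degree-pos⇒touches G/e (subst (1 ≤_) (sym (degree-G/e-x D)) pos)))

    through-e : degree G D x ≡ 1 → degree G D y ≡ 1 → IsCycle G (D ∪ ⁅ e ⁆)
    through-e dx≡1 dy≡1 = (e , y∈p∪⁅y⁆) , linked , regular
      where
      from-x : ∀ {f} → f ∈ D ∪ ⁅ e ⁆ → Reach G (D ∪ ⁅ e ⁆) x (end₁ G f)
      from-x f∈ with x∈p∪⁅y⁆⁻ f∈
      ... | inj₂ refl = here
      ... | inj₁ f∈D with degree-pos⇒touches G (subst (1 ≤_) (sym dx≡1) (s≤s z≤n))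
      ...   | h , h∈D , x-end =
        Reach-trans G (Reach-end G (p⊆p∪q _ h∈D) x-end)
                      (Reach-lift (proj₁ (proj₂ cycle) h _ h∈D f∈D) refl refl)

      linked : ∀ f g → f ∈ D ∪ ⁅ e ⁆ → g ∈ D ∪ ⁅ e ⁆ → Linked G (D ∪ ⁅ e ⁆) f g
      linked f g f∈ g∈ = Reach-trans G (Reach-sym G (from-x f∈)) (from-x g∈)

      regular : ∀ w → Touches G (D ∪ ⁅ e ⁆) w → degree G (D ∪ ⁅ e ⁆) w ≡ 2
      regular w w-touches = trans (degree-∪⁅⁆ G w e∉D) (by-cases w-touches)
        where
        by-cases : Touches G (D ∪ ⁅ e ⁆) w → degree G D w + incidence G e w ≡ 2
        by-cases w-touches with w ≟ x | w ≟ y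
        ... | yes refl | _        = cong₂ _+_ dx≡1 (cong₂ _+_ (δ-refl x) (δ-≢ (x≢y ∘ sym)))
        ... | no _     | yes refl = cong₂ _+_ dy≡1 (cong₂ _+_ (δ-≢ x≢y) (δ-refl y))
        ... | no w≢x   | no w≢y   = begin
          degree G D w + (δ x w + δ y w) ≡⟨ cong (degree G D w +_) (cong₂ _+_ (δ-≢ (w≢x ∘ sym))
                                                                         (δ-≢ (w≢y ∘ sym))) ⟩
          degree G D w + 0                ≡⟨ +-identityʳ _ ⟩
          degree G D w                    ≡⟨ degree-G/e-other D w≢x w≢y ⟨
          degree G/e D w                  ≡⟨ proj₂ (proj₂ cycle) w (touches-G/e w-touches) ⟩
          2                               ∎
          where
          open ≡-Reasoning
          touches-G/e : Touches G (D ∪ ⁅ e ⁆) w → Touches G/e D w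
          touches-G/e (g , g∈ , w-end) with x∈p∪⁅y⁆⁻ g∈ | w-end
          ... | inj₁ g∈D  | inj₁ refl = g , g∈D , inj₁ (redirect-≢ w≢y)
          ... | inj₁ g∈D  | inj₂ refl = g , g∈D , inj₂ (redirect-≢ w≢y)
          ... | inj₂ refl | inj₁ refl = contradiction refl w≢x
          ... | inj₂ refl | inj₂ refl = contradiction refl w≢y

    lift-cycle : IsCycle G D ⊎ IsCycle G (D ∪ ⁅ e ⁆)
    lift-cycle with degree G D x in dx | degree G D y in dy
    ... | _     | zero  = inj₁ (avoiding-y dy)
    ... | zero  | suc _ = inj₁ (avoiding-x dx)
    ... | suc a | suc b = inj₂ (through-e (trans dx (proj₁ (both-one sum≡2))) (trans dy (proj₂ (both-one sum≡2))))
      where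
      sum≡2 : suc a + suc b ≡ 2
      sum≡2 = trans (sym (cong₂ _+_ dx dy)) (degree-x+y (subst (1 ≤_) (sym (cong₂ _+_ dx dy)) (s≤s z≤n)))
      both-one : ∀ {a b} → suc a + suc b ≡ 2 → suc a ≡ 1 × suc b ≡ 1
      both-one {a} {b} eq = cong suc (m+n≡0⇒m≡0 a a+b≡0) , cong suc (m+n≡0⇒n≡0 a a+b≡0)
        where
        a+b≡0 : a + b ≡ 0
        a+b≡0 = suc-injective (trans (sym (+-suc a b)) (suc-injective eq))

  acyclic-G/e : ∀ {J} → e ∈ J → Acyclic G J → Acyclic G/e (J - e)
  acyclic-G/e {J} e∈J acyclic (D , D⊆J-e , cycle) =
    [ (λ cycle-D  → acyclic (D , D⊆J , cycle-D))
    , (λ cycle-De → acyclic (D ∪ ⁅ e ⁆ , p∪⁅x⁆⊆q D⊆J e∈J , cycle-De)) ]′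
      (lift-cycle (λ e∈D → proj₂ (x∈p-y⁻ (D⊆J-e e∈D)) refl) cycle)
    where
    D⊆J : D ⊆ J
    D⊆J = proj₁ ∘ x∈p-y⁻ ∘ D⊆J-e

forest-bound : (G : Graph) (J : Subset (Graph.nE G)) (V : Subset (Graph.nV G)) → Acyclic G J →
               (∀ {e} → e ∈ J → end₁ G e ∈ V × end₂ G e ∈ V) → Nonempty V → suc ∣ J ∣ ≤ ∣ V ∣
forest-bound G J V = go G J V (<-wellFounded ∣ J ∣)
  where
  go : ∀ G J V → Acc _<_ ∣ J ∣ → Acyclic G J → (∀ {e} → e ∈ J → end₁ G e ∈ V × end₂ G e ∈ V) →
       Nonempty V → suc ∣ J ∣ ≤ ∣ V ∣
  go G J V (acc smaller) acyclic ends∈V V≢∅ with nonempty? J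
  ... | no J≡∅ = subst (λ j → suc j ≤ ∣ V ∣) (sym ∣J∣≡0) (nonempty⇒∣p∣≥1 V≢∅)
    where
    ∣J∣≡0 : ∣ J ∣ ≡ 0
    ∣J∣≡0 = trans (cong ∣_∣ (Empty-unique J≡∅)) (∣⊥∣≡0 (Graph.nE G))
  ... | yes (e , e∈J) with end₁ G e ≟ end₂ G e
  ...   | yes loop = contradiction (⁅ e ⁆ , (λ {f} → ⁅x⁆⊆p e∈J {f}) , loop-isCycle G e loop) acyclic
  ...   | no  x≢y  = subst₂ _≤_ (cong suc (1+∣p-x∣≡∣p∣ e∈J)) (1+∣p-x∣≡∣p∣ y∈V) (s≤s bound-G/e)
    where
    open Contraction G e x≢y
    y∈V = proj₂ (ends∈V e∈J)
    x∈V = proj₁ (ends∈V e∈J)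

    redirect∈V-y : ∀ {a} → a ∈ V → redirect y x a ∈ V - y
    redirect∈V-y {a} a∈V with a ≟ y
    ... | yes refl = x∈p∧x≢y⇒x∈p-y x∈V x≢y
    ... | no  a≢y  = x∈p∧x≢y⇒x∈p-y a∈V a≢y

    bound-G/e : suc ∣ J - e ∣ ≤ ∣ V - y ∣
    bound-G/e = go G/e (J - e) (V - y) (smaller (x∈p⇒∣p-x∣<∣p∣ e∈J)) (acyclic-G/e e∈J acyclic)
      (λ g∈J-e → ends∈V-y (ends∈V (proj₁ (x∈p-y⁻ g∈J-e)))) (x , x∈p∧x≢y⇒x∈p-y x∈V x≢y)
      where
      ends∈V-y : ∀ {a b} → a ∈ V × b ∈ V → redirect y x a ∈ V - y × redirect y x b ∈ V - y
      ends∈V-y (a∈V , b∈V) = redirect∈V-y a∈V , redirect∈V-y b∈V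

-- Lifts of the cycle matroid

module _ (G : Graph) where
  open Graph G

  acyclic-⊥ : Acyclic G ⊥
  acyclic-⊥ (D , D⊆⊥ , (f , f∈D) , _) = ∉⊥ (D⊆⊥ f∈D)

  -- e is a coloop of M(G) | (X ∪ {e})
  NoCycleThrough : Subset nE → Fin nE → Set
  NoCycleThrough X e = ∀ D → D ⊆ X ∪ ⁅ e ⁆ → e ∈ D → ¬ IsCycle G D

  acyclic-∪⁅⁆ : ∀ {X S e} → NoCycleThrough X e → S ⊆ X → Acyclic G S → Acyclic G (S ∪ ⁅ e ⁆)
  acyclic-∪⁅⁆ {X} {S} {e} no-cycle S⊆X acyclic (D , D⊆S∪e , cycle) with e ∈? D
  ... | yes e∈D = no-cycle D (⊆-∪⁅⁆ ∘ D⊆S∪e) e∈D cycle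
    where
    ⊆-∪⁅⁆ : ∀ {f} → f ∈ S ∪ ⁅ e ⁆ → f ∈ X ∪ ⁅ e ⁆
    ⊆-∪⁅⁆ f∈ with x∈p∪⁅y⁆⁻ f∈
    ... | inj₁ f∈S  = p⊆p∪q _ (S⊆X f∈S)
    ... | inj₂ refl = y∈p∪⁅y⁆
  ... | no  e∉D = acyclic (D , D⊆S , cycle)
    where
    D⊆S : D ⊆ S
    D⊆S f∈D with x∈p∪⁅y⁆⁻ (D⊆S∪e f∈D)
    ... | inj₁ f∈S  = f∈S
    ... | inj₂ refl = contradiction f∈D e∉D

module LiftOfCycleMatroid (G : Graph) (M : Matroid (Graph.nE G)) (M′ : Matroid (suc (Graph.nE G)))
  (deletion : ∀ X → deleteIndep M′ X ≡ Matroid.indep M X)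
  (contraction : ∀ X → (contractIndep M′ X ≡ true) ⇔ Acyclic G X) where

  open Graph G
  open Matroid M′ using (indep; indep-⊆; indep-aug)

  indep-outside⇒Indep : ∀ {X} → indep (outside ∷ X) ≡ true → Indep M X
  indep-outside⇒Indep {X} = trans (sym (deletion X))

  Indep⇒indep-outside : ∀ {X} → Indep M X → indep (outside ∷ X) ≡ true
  Indep⇒indep-outside {X} = trans (deletion X)

  zero-loop? : indep ⁅ zero ⁆ ≡ false ⊎ indep ⁅ zero ⁆ ≡ true
  zero-loop? with indep ⁅ zero ⁆
  ... | false = inj₁ refl
  ... | true  = inj₂ refl

  -- if 0 is a loop of M′ then M = M′ \ 0 = M′ / 0 = M(G)
  contraction-loop : indep ⁅ zero ⁆ ≡ false → ∀ {X} → Indep M X ⇔ Acyclic G X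
  contraction-loop loop {X} = subst (λ b → (b ≡ true) ⇔ Acyclic G X)
    (trans (cong (if_then indep (inside ∷ X) else indep (outside ∷ X)) loop) (deletion X)) (contraction X)

  contraction-nonloop : indep ⁅ zero ⁆ ≡ true → ∀ {X} → (indep (inside ∷ X) ≡ true) ⇔ Acyclic G X
  contraction-nonloop nonloop {X} = subst (λ b → (b ≡ true) ⇔ Acyclic G X)
    (cong (if_then indep (inside ∷ X) else indep (outside ∷ X)) nonloop) (contraction X)

  acyclic⇒indep : ∀ {X} → Acyclic G X → Indep M X
  acyclic⇒indep acyclic with zero-loop?
  ... | inj₁ loop    = Equivalence.from (contraction-loop loop) acyclic
  ... | inj₂ nonloop =
    indep-outside⇒Indep (indep-⊆ (out⊆ id) (Equivalence.from (contraction-nonloop nonloop) acyclic))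

  -- r(M′ \ 0) ≤ r(M′ / 0) + 1
  indep⇒large-acyclic : ∀ {I} → Indep M I → ∃[ J ] (J ⊆ I × Acyclic G J × ∣ I ∣ ≤ suc ∣ J ∣)
  indep⇒large-acyclic {I} indI with zero-loop?
  ... | inj₁ loop = I , id , Equivalence.to (contraction-loop loop) indI , n≤1+n _
  ... | inj₂ nonloop with ∣ I ∣ in ∣I∣≡
  ...   | zero  = ⊥ , (λ f∈⊥ → contradiction f∈⊥ ∉⊥) , acyclic-⊥ G , z≤n
  ...   | suc d with extend-to-size M′ d {⁅ zero ⁆} {outside ∷ I} nonloop (Indep⇒indep-outside indI)
                       (trans ∣I∣≡ (trans (+-comm 1 d) (cong (d +_) (sym (∣⁅x⁆∣≡1 (zero {nE}))))))
  ...     | inside ∷ J , zero∈Z , Z⊆zero∪I , indZ , ∣Z∣≡ =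
    J , J⊆I , Equivalence.to (contraction-nonloop nonloop) indZ , ≤-reflexive (trans (sym ∣I∣≡) (sym ∣Z∣≡))
    where
    J⊆I : J ⊆ I
    J⊆I f∈J with x∈p∪q⁻ ⊥ I (drop-there (Z⊆zero∪I (there f∈J)))
    ... | inj₁ f∈⊥ = contradiction f∈⊥ ∉⊥
    ... | inj₂ f∈I = f∈I
  ...     | outside ∷ J , zero∈Z , _ = contradiction (zero∈Z here) λ ()

  -- Augment outside ∷ X from the larger independent set inside ∷ (J ∪ ⁅ e ⁆): the added element is
  -- either 0, and then X is already a forest, or e itself.
  indep-∪⁅⁆ : ∀ {X e} → Indep M X → e ∉ X → NoCycleThrough G X e → Indep M (X ∪ ⁅ e ⁆)
  indep-∪⁅⁆ {X} {e} indX e∉X no-cycle with zero-loop?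
  ... | inj₁ loop =
    Equivalence.from (contraction-loop loop)
      (acyclic-∪⁅⁆ G no-cycle id (Equivalence.to (contraction-loop loop) indX))
  ... | inj₂ nonloop with indep⇒large-acyclic indX
  ...   | J , J⊆X , acyclicJ , ∣X∣≤1+∣J∣
    with indep-aug (Indep⇒indep-outside indX)
                   (Equivalence.from (contraction-nonloop nonloop) (acyclic-∪⁅⁆ G no-cycle J⊆X acyclicJ))
                   (s≤s (≤-trans ∣X∣≤1+∣J∣ (≤-reflexive (sym (∣p∪⁅x⁆∣≡1+∣p∣ (e∉X ∘ J⊆X))))))
  ...     | zero , _ , _ , indX+e = acyclic⇒indep (acyclic-∪⁅⁆ G no-cycle id acyclicX)
    where
    acyclicX : Acyclic G X
    acyclicX = Equivalence.to (contraction-nonloop nonloop)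
                 (subst (λ Y → indep (inside ∷ Y) ≡ true) (∪-identityʳ X) indX+e)
  ...     | suc g , there g∈J∪e , g∉X , indX+g with x∈p∪⁅y⁆⁻ g∈J∪e
  ...       | inj₁ g∈J  = contradiction (there (J⊆X g∈J)) g∉X
  ...       | inj₂ refl = indep-outside⇒Indep indX+g

  indep-no-disjoint-cycles : ∀ {I D₁ D₂} → Indep M I → D₁ ⊆ I → D₂ ⊆ I → IsCycle G D₁ → IsCycle G D₂ →
                             (∀ {f} → f ∈ D₁ → f ∉ D₂) → ⊥₀
  indep-no-disjoint-cycles {I} {D₁} {D₂} indI D₁⊆I D₂⊆I cycle₁ cycle₂ disjoint with indep⇒large-acyclic indI
  ... | J , J⊆I , acyclicJ , ∣I∣≤1+∣J∣ with ⊆-or-outside D₁ J | ⊆-or-outside D₂ J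
  ...   | inj₁ D₁⊆J | _         = acyclicJ (D₁ , D₁⊆J , cycle₁)
  ...   | _         | inj₁ D₂⊆J = acyclicJ (D₂ , D₂⊆J , cycle₂)
  ...   | inj₂ (f₁ , f₁∈D₁ , f₁∉J) | inj₂ (f₂ , f₂∈D₂ , f₂∉J) = 1+n≰n (≤-trans ∣J∣+2≤∣I∣ ∣I∣≤1+∣J∣)
    where
    ∣J∣+2≤∣I∣ : suc (suc ∣ J ∣) ≤ ∣ I ∣
    ∣J∣+2≤∣I∣ = x,y∈q∖p⇒2+∣p∣≤∣q∣ J⊆I (D₁⊆I f₁∈D₁) (D₂⊆I f₂∈D₂) f₁∉J f₂∉J
                                   (λ { refl → disjoint f₁∈D₁ f₂∈D₂ })

  disjoint-cycles-dependent : ∀ C₁ C₂ → IsCycle G C₁ → IsCycle G C₂ → VertexDisjoint G C₁ C₂ →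
                              ¬ Indep M (C₁ ∪ C₂)
  disjoint-cycles-dependent C₁ C₂ cycle₁ cycle₂ disjoint indC =
    indep-no-disjoint-cycles indC (p⊆p∪q C₂) (q⊆p∪q C₁ C₂) cycle₁ cycle₂
      (λ {f} f∈C₁ f∈C₂ → disjoint (end₁ G f) ((f , f∈C₁ , inj₁ refl) , (f , f∈C₂ , inj₁ refl)))

  component-rank : ∀ VS → IsComponent G VS → RankLe M (componentEdges G VS) ∣ VS ∣
  component-rank VS (VS≢∅ , _ , closed) I I⊆E indI with indep⇒large-acyclic indI
  ... | J , J⊆I , acyclicJ , ∣I∣≤1+∣J∣ = ≤-trans ∣I∣≤1+∣J∣ (forest-bound G J VS acyclicJ ends∈VS VS≢∅)
    where
    ends∈VS : ∀ {f} → f ∈ J → end₁ G f ∈ VS × end₂ G f ∈ VS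
    ends∈VS {f} f∈J = end₁∈VS , proj₁ (closed f) end₁∈VS
      where
      end₁∈VS : end₁ G f ∈ VS
      end₁∈VS = lookup⇒[]= (end₁ G f) VS (Equivalence.to ∈-tabulate⇔ (I⊆E (J⊆I f∈J)))

  closure-avoiding : ∀ v e → InClosure M (edgesAvoiding G v) e → e ∈ edgesAvoiding G v ⊎ IsLoopAt G v e
  closure-avoiding v e (k , ((B , B⊆X , indB , ∣B∣≡k) , _) , (_ , rank≤k)) with avoiding⊎loop⊎end G v e
  ... | inj₁ e∈X         = inj₁ e∈X
  ... | inj₂ (inj₁ loop) = inj₂ loop
  ... | inj₂ (inj₂ (v-end , incidence≡1)) = contradiction rank-exceeded 1+n≰n
    where
    e∉B : e ∉ B
    e∉B e∈B = 0≢1+n (trans (sym (incidence-avoiding G (B⊆X e∈B))) incidence≡1)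

    no-cycle : NoCycleThrough G B e
    no-cycle D D⊆B∪e e∈D (_ , _ , regular) = 1+n≢n (trans (sym (regular v (e , e∈D , v-end))) degree≡1)
      where
      others : ∀ {g} → g ∈ D → g ≢ e → incidence G g v ≡ 0
      others g∈D g≢e with x∈p∪⁅y⁆⁻ (D⊆B∪e g∈D)
      ... | inj₁ g∈B = incidence-avoiding G (B⊆X g∈B)
      ... | inj₂ g≡e = contradiction g≡e g≢e

      degree≡1 : degree G D v ≡ 1
      degree≡1 = trans (degree-through G e e∈D others) incidence≡1

    rank-exceeded : suc k ≤ k
    rank-exceeded = subst (_≤ k) (trans (∣p∪⁅x⁆∣≡1+∣p∣ e∉B) (cong suc ∣B∣≡k))
      (rank≤k (B ∪ ⁅ e ⁆) (p∪⁅x⁆⊆q (p⊆p∪q _ ∘ B⊆X) y∈p∪⁅y⁆) (indep-∪⁅⁆ indB e∉B no-cycle))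

  module _ {C} (circuit : Circuit M C) where

    circuit-component-cyclic : ∀ {z} → z ∈ C → ¬ Acyclic G (componentOf G C z)
    circuit-component-cyclic {z} z∈C acyclic =
      proj₁ circuit (Matroid.indep-⊆ M (p⊆p-x∪⁅x⁆ C z)
        (indep-∪⁅⁆ (proj₂ circuit (C - z) (x∈p⇒p-x⊂p z∈C)) (λ z∈C-z → proj₂ (x∈p-y⁻ z∈C-z) refl)
                   no-cycle))
      where
      no-cycle : NoCycleThrough G (C - z) z
      no-cycle D D⊆C-z∪z z∈D cycle = acyclic (D , D⊆component , cycle)
        where
        D⊆C : D ⊆ C
        D⊆C f∈D with x∈p∪⁅y⁆⁻ (D⊆C-z∪z f∈D)
        ... | inj₁ f∈C-z = proj₁ (x∈p-y⁻ f∈C-z)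
        ... | inj₂ refl  = z∈C
        D⊆component : D ⊆ componentOf G C z
        D⊆component {f} f∈D =
          ∈-componentOf⁺ G (D⊆C f∈D) (Reach-mono G D⊆C (proj₁ (proj₂ cycle) z f z∈D f∈D))

    -- Cycles in the components of a and b lie in the independent set C - c and are disjoint.
    no-three-components : ∀ {a b c} → a ∈ C → b ∈ C → c ∈ C →
                          ¬ Linked G C a b → ¬ Linked G C a c → ¬ Linked G C b c → ⊥₀
    no-three-components {a} {b} {c} a∈C b∈C c∈C a≁b a≁c b≁c =
      circuit-component-cyclic a∈C λ (D₁ , D₁⊆ , cycle₁) →
      circuit-component-cyclic b∈C λ (D₂ , D₂⊆ , cycle₂) →
      indep-no-disjoint-cycles (proj₂ circuit (C - c) (x∈p⇒p-x⊂p c∈C))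
        (⊆C-c a≁c ∘ D₁⊆) (⊆C-c b≁c ∘ D₂⊆) cycle₁ cycle₂
        (λ f∈D₁ f∈D₂ → a≁b (Linked-common G (linked-to D₁⊆ f∈D₁) (linked-to D₂⊆ f∈D₂)))
      where
      linked-to : ∀ {D z f} → D ⊆ componentOf G C z → f ∈ D → Linked G C z f
      linked-to D⊆ f∈D = proj₂ (∈-componentOf⁻ G (D⊆ f∈D))

      ⊆C-c : ∀ {z f} → ¬ Linked G C z c → f ∈ componentOf G C z → f ∈ C - c
      ⊆C-c z≁c f∈ with ∈-componentOf⁻ G f∈
      ... | f∈C , z~f = x∈p∧x≢y⇒x∈p-y f∈C λ { refl → z≁c z~f }

    circuit-two-components :
      ∃[ a ] ∃[ b ] (a ∈ C × b ∈ C × (∀ f → f ∈ C → Linked G C a f ⊎ Linked G C b f))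
    circuit-two-components with nonempty? C
    ... | no C≡∅ = contradiction (subst (Indep M) (sym (Empty-unique C≡∅)) (Matroid.indep-∅ M)) (proj₁ circuit)
    ... | yes (a , a∈C) with any? (λ f → f ∈? C ×-dec ¬? (Linked? G C a f))
    ...   | no all-linked = a , a , a∈C , a∈C , λ f f∈C →
      inj₁ (decidable-stable (Linked? G C a f) (λ a≁f → all-linked (f , f∈C , a≁f)))
    ...   | yes (b , b∈C , a≁b)
      with any? (λ f → f ∈? C ×-dec (¬? (Linked? G C a f) ×-dec ¬? (Linked? G C b f)))
    ...     | yes (c , c∈C , a≁c , b≁c) = ⊥-elim (no-three-components a∈C b∈C c∈C a≁b a≁c b≁c)
    ...     | no none = a , b , a∈C , b∈C , covered
      where
      covered : ∀ f → f ∈ C → Linked G C a f ⊎ Linked G C b f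
      covered f f∈C with Linked? G C a f | Linked? G C b f
      ... | yes a~f | _       = inj₁ a~f
      ... | no  _   | yes b~f = inj₂ b~f
      ... | no  a≁f | no  b≁f = contradiction (f , f∈C , a≁f , b≁f) none

theorem6p1 : (G : Graph) (M : Matroid (Graph.nE G)) →
    IsLiftOfCycleMatroid G M →
    IsFramework G M
    × (∀ C₁ C₂ → IsCycle G C₁ → IsCycle G C₂ → VertexDisjoint G C₁ C₂ →
         ¬ Indep M (C₁ ∪ C₂))
theorem6p1 G M (M′ , deletion , contraction) =
  (component-rank , closure-avoiding , λ C circuit → circuit-two-components circuit) , disjoint-cycles-dependent
  where open LiftOfCycleMatroid G M M′ deletion contraction
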